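{- Let $d$ be a positive integer and let $f\colon\mathbb{N}^d\to\mathbb{N}$ be any $d$-tupling function. Then $f$ has cubic shells if and only if, for all points $(x_1,x_2,\ldots,x_d)\in\mathbb{N}^d$, $$m^d\leq f(x_1,x_2,\ldots,x_d)<(m+1)^d,\qquad\text{where } m=\max(x_1,x_2,\ldots,x_d).$$
   Context: $\mathbb{N}$ denotes the set of non-negative integers. A $d$-tupling function for $\mathbb{N}$ is a bijection from $\mathbb{N}^d$ to $\mathbb{N}$. A function $\sigma\colon\mathbb{N}^d\to\mathbb{N}$ is a shell numbering for a $d$-tupling function $f$ if for all $\mathbf{x},\mathbf{y}\in\mathbb{N}^d$, $\sigma(\mathbf{x})<\sigma(\mathbf{y})$ implies $f(\mathbf{x})<f(\mathbf{y})$. The function $f$ is said to have cubic shells if $\max(x_1,\ldots,x_d)$ is a shell numbering for $f$. -}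

module Defs where

open import Data.Nat using (ℕ; _⊔_; _<_)
open import Data.Vec using (Vec; foldr)
open import Function.Definitions using (Bijective)
open import Relation.Binary.PropositionalEquality using (_≡_)

-- points of ℕ^d are vectors of length d
-- max(x₁,…,xₙ); for d ≥ 1 this is the usual maximum (0 is neutral for ⊔ on ℕ)
vmax : ∀ {d} → Vec ℕ d → ℕ
vmax = foldr _ _⊔_ 0

IsTupling : (d : ℕ) → (Vec ℕ d → ℕ) → Set
IsTupling d f = Bijective _≡_ _≡_ f

IsShellNumbering : (d : ℕ) → (Vec ℕ d → ℕ) → (Vec ℕ d → ℕ) → Set
IsShellNumbering d σ f = ∀ (x y : Vec ℕ d) → σ x < σ y → f x < f y

HasCubicShells : (d : ℕ) → (Vec ℕ d → ℕ) → Set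
HasCubicShells d f = IsShellNumbering d vmax f

module Submission where

-- Call the cube of side s the set of points x ∈ ℕ^d with
-- max(x) < s; it has exactly s^d points.
-- For a tupling function f with cubic shells and m = max(x):
--   * every point of the cube of side m lies in a lower shell than x, so f
--     maps that cube injectively below f x, giving m^d ≤ f x;
--   * the preimages of 0, …, f x all lie in the cube of side m + 1 (a point
--     in a higher shell would have a larger value), giving f x + 1 ≤ (m+1)^d.
-- Conversely the bounds place shell m inside [m^d, (m+1)^d), and these
-- intervals are increasing in m, so max is a shell numbering.

open import Defs
open import Data.Nat using (ℕ; suc; _≤_; _<_; _^_; NonZero)
open import Data.Vec using (Vec)
open import Data.Product using (_×_)
open import Function.Bundles using (_⇔_)

open import Data.Nat using (zero; z≤n; s≤s)
open import Data.Nat.Properties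
  using (<-≤-trans; ≤-trans; ≤-pred; <⇒≱; ≮⇒≥; ^-monoˡ-≤; m⊔n<o⇒m<o; m⊔n<o⇒n<o; ⊔-lub)
open import Data.Fin as Fin using (Fin; toℕ; fromℕ<; combine; remQuot)
open import Data.Fin.Properties
  using (toℕ<n; toℕ-injective; toℕ-fromℕ<; fromℕ<-injective; combine-injective; combine-remQuot; injective⇒≤)
open import Data.Vec using ([]; _∷_)
open import Data.Vec.Properties using (∷-injectiveˡ; ∷-injectiveʳ)
open import Data.Product using (_,_; proj₁; proj₂; uncurry)
open import Function.Bundles using (mk⇔)
open import Function.Definitions using (Injective; Surjective)
open import Relation.Binary.PropositionalEquality using (_≡_; refl; sym; trans; cong; cong₂; module ≡-Reasoning)

-- The index of a point of the cube of side s, read as a d-digit numeral in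
-- base s.
cubeIndex : ∀ {s d} (x : Vec ℕ d) → vmax x < s → Fin (s ^ d)
cubeIndex []      _   = Fin.zero
cubeIndex (a ∷ x) x<s = combine (fromℕ< (m⊔n<o⇒m<o a (vmax x) x<s))
                                (cubeIndex x (m⊔n<o⇒n<o a (vmax x) x<s))

cubeIndex-injective : ∀ {s d} (x y : Vec ℕ d) (x<s : vmax x < s) (y<s : vmax y < s) →
                      cubeIndex x x<s ≡ cubeIndex y y<s → x ≡ y
cubeIndex-injective []      []      _   _   _  = refl
cubeIndex-injective {s} (a ∷ x) (b ∷ y) x<s y<s eq =
  cong₂ _∷_ (fromℕ<-injective a b _ _ (proj₁ digits)) (cubeIndex-injective x y _ _ (proj₂ digits))
  where digits = combine-injective {s} _ _ _ _ eq

cubePoint : ∀ {s} d → Fin (s ^ d) → Vec ℕ d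
cubePoint zero    _ = []
cubePoint {s} (suc d) i = digits (remQuot {s} (s ^ d) i)
  where
  digits : Fin s × Fin (s ^ d) → Vec ℕ (suc d)
  digits (a , j) = toℕ a ∷ cubePoint d j

cubePoint-injective : ∀ {s} d {i j : Fin (s ^ d)} → cubePoint d i ≡ cubePoint d j → i ≡ j
cubePoint-injective zero {Fin.zero} {Fin.zero} _ = refl
cubePoint-injective {s} (suc d) {i} {j} eq = begin
  i                                       ≡⟨ sym (combine-remQuot {s} (s ^ d) i) ⟩
  uncurry combine (remQuot {s} (s ^ d) i) ≡⟨ cong₂ combine heads tails ⟩
  uncurry combine (remQuot {s} (s ^ d) j) ≡⟨ combine-remQuot {s} (s ^ d) j ⟩
  j                                       ∎
  where
  open ≡-Reasoning
  heads : proj₁ (remQuot {s} (s ^ d) i) ≡ proj₁ (remQuot {s} (s ^ d) j)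
  heads = toℕ-injective (∷-injectiveˡ eq)
  tails : proj₂ (remQuot {s} (s ^ d) i) ≡ proj₂ (remQuot {s} (s ^ d) j)
  tails = cubePoint-injective d (∷-injectiveʳ eq)

-- Every enumerated point lies in the cube (the side must be positive, which
-- matters only in dimension 0).
cubePoint-inCube : ∀ {s} d → 0 < s → (i : Fin (s ^ d)) → vmax (cubePoint d i) < s
cubePoint-inCube zero    0<s _ = 0<s
cubePoint-inCube {s} (suc d) 0<s i =
  ⊔-lub (toℕ<n (proj₁ (remQuot {s} (s ^ d) i))) (cubePoint-inCube d 0<s (proj₂ (remQuot {s} (s ^ d) i)))

nonemptyCube⇒positiveSide : ∀ {s d} → Fin (s ^ suc d) → 0 < s
nonemptyCube⇒positiveSide {suc _} _ = s≤s z≤n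

pointsInCube≤ : ∀ {n s d} (g : Fin n → Vec ℕ d) → Injective _≡_ _≡_ g →
                (inCube : ∀ i → vmax (g i) < s) → n ≤ s ^ d
pointsInCube≤ g g-inj inCube =
  injective⇒≤ (λ {i} {j} eq → g-inj (cubeIndex-injective (g i) (g j) (inCube i) (inCube j) eq))

cubeBelow⇒size≤ : ∀ {s d N} (h : Vec ℕ (suc d) → ℕ) → Injective _≡_ _≡_ h →
        (below : ∀ x → vmax x < s → h x < N) → s ^ suc d ≤ N
cubeBelow⇒size≤ {s} {d} h h-inj below = injective⇒≤ {f = index} index-injective
  where
  point : Fin (s ^ suc d) → Vec ℕ (suc d)
  point = cubePoint {s} (suc d)

  point-inCube : ∀ i → vmax (point i) < s
  point-inCube i = cubePoint-inCube {s} (suc d) (nonemptyCube⇒positiveSide {s} {d} i) i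

  index : Fin (s ^ suc d) → Fin _
  index i = fromℕ< (below (point i) (point-inCube i))

  index-injective : Injective _≡_ _≡_ index
  index-injective {i} {j} eq = cubePoint-injective (suc d) (h-inj (begin
    h (point i)   ≡⟨ sym (toℕ-fromℕ< _) ⟩
    toℕ (index i) ≡⟨ cong toℕ eq ⟩
    toℕ (index j) ≡⟨ toℕ-fromℕ< _ ⟩
    h (point j)   ∎))
    where open ≡-Reasoning

ShellBounds : (d : ℕ) → (Vec ℕ d → ℕ) → Set
ShellBounds d f = ∀ (x : Vec ℕ d) → (vmax x ^ d ≤ f x) × (f x < suc (vmax x) ^ d)

shellBounds⇒cubicShells : ∀ {d} (f : Vec ℕ d → ℕ) → ShellBounds d f → HasCubicShells d f
shellBounds⇒cubicShells {d} f bounds x y mx<my =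
  <-≤-trans (proj₂ (bounds x)) (≤-trans (^-monoˡ-≤ d mx<my) (proj₁ (bounds y)))

-- Lower bound from injectivity: the cube of side max(x) is mapped below f x.
cubicShells⇒lowerBound : ∀ {d} (f : Vec ℕ (suc d) → ℕ) → Injective _≡_ _≡_ f →
                         HasCubicShells (suc d) f → ∀ x → vmax x ^ suc d ≤ f x
cubicShells⇒lowerBound f f-inj shells x = cubeBelow⇒size≤ f f-inj (λ y my<mx → shells y x my<mx)

-- Upper bound from surjectivity: the preimages of 0, …, f x are distinct
-- points of the cube of side max(x) + 1.
cubicShells⇒upperBound : ∀ {d} (f : Vec ℕ d → ℕ) → Surjective _≡_ _≡_ f →
                         HasCubicShells d f → ∀ x → f x < suc (vmax x) ^ d
cubicShells⇒upperBound f f-surj shells x = pointsInCube≤ preimage preimage-injective preimage-inCube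
  where
  preimage : Fin (suc (f x)) → Vec ℕ _
  preimage i = proj₁ (f-surj (toℕ i))

  f-preimage : ∀ i → f (preimage i) ≡ toℕ i
  f-preimage i = proj₂ (f-surj (toℕ i)) refl

  preimage-injective : Injective _≡_ _≡_ preimage
  preimage-injective {i} {j} eq =
    toℕ-injective (trans (sym (f-preimage i)) (trans (cong f eq) (f-preimage j)))

  -- a preimage in a higher shell than x would have value above f x
  preimage-inCube : ∀ i → vmax (preimage i) < suc (vmax x)
  preimage-inCube i = s≤s (≮⇒≥ λ mx<mp → <⇒≱ (shells x (preimage i) mx<mp) value≤fx)
    where
    value≤fx : f (preimage i) ≤ f x
    value≤fx rewrite f-preimage i = ≤-pred (toℕ<n i)

corollary6 : (d : ℕ) → .{{_ : NonZero d}} → (f : Vec ℕ d → ℕ) → IsTupling d f →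
    HasCubicShells d f ⇔ (∀ (x : Vec ℕ d) → (vmax x ^ d ≤ f x) × (f x < suc (vmax x) ^ d))
corollary6 (suc d) f (f-inj , f-surj) = mk⇔ bounds (shellBounds⇒cubicShells f)
  where
  bounds : HasCubicShells (suc d) f → ShellBounds (suc d) f
  bounds shells x = cubicShells⇒lowerBound f f-inj shells x , cubicShells⇒upperBound f f-surj shells x
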